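{- Let $H=(V,E)$ be a $k$-uniform hypergraph and $U\subseteq V$ such that every edge $e\in E$ satisfies $|e\cap U|\le 2$. Then, over the polynomial ring over $\mathrm{GF}(2^m)$ (for any positive integer $m$) in the variables $s$ and $\{v_e\}_{e\in E}$, $$\det(\mathbf{T}^{(s)}(H,U))=\sum_{M\in\mathcal{M}}s^{\Lambda(M)}\prod_{e\in M}v_e^{p(e)},$$ where $\mathcal{M}$ is the set of all perfect matchings in $H[U]$, $\Lambda(M)$ is the number of loops in $M$, and $p(e)=1$ if $e$ is a loop and $p(e)=2$ otherwise.
   Context: A hypergraph $H=(V,E)$ has vertex set $V$ and a multiset $E$ of edges (subsets of $V$); $k$-uniform means every edge has $k$ vertices. For $U\subseteq V$ the projected hypergraph $H[U]$ has one edge $e\cap U$ for each $e\in E$ (each occurrence). A projected edge of size one, $e\cap U=\{i\}$, is called a loop at $i$ and is regarded as covering $i$; a projected edge of size two $\{i,j\}$ covers $i$ and $j$. A perfect matching of $H[U]$ is a set $M$ of edges $e\in E$ with nonempty projections such that every vertex of $U$ is covered by exactly one $e\cap U$, $e\in M$. Each $e\in E$ has its own variable $v_e$, and $s$ is an additional variable. The Tutte matrix of index $s$, $\mathbf{T}^{(s)}(H,U)$, is the $|U|\times|U|$ matrix with rows and columns indexed by $U$, where for $i\ne j$ the entry $(i,j)$ is $\sum v_e$ over all $e\in E$ with $e\cap U=\{i,j\}$, and the diagonal entry $(i,i)$ is $s\sum v_e$ over all $e\in E$ with $e\cap U=\{i\}$ (empty sums are zero). -}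

module Defs where

open import Level using (Level)
open import Data.Bool using (Bool; true; false; if_then_else_)
open import Data.Nat as ℕ using (ℕ; zero; suc)
open import Data.Fin using (Fin; zero; suc; toℕ; punchIn; _≟_)
open import Data.Fin.Subset using (Subset; _∈_; _∩_; _∪_; ⁅_⁆; ⊥; ∣_∣; inside; outside)
open import Data.Fin.Subset.Properties using (_∈?_)
open import Data.Vec using (Vec; []; _∷_; tabulate; lookup)
open import Data.Vec.Properties using (≡-dec)
import Data.Bool.Properties as BoolP
open import Data.Product using (_×_)
open import Relation.Binary.PropositionalEquality using (_≡_)
open import Relation.Nullary using (Dec; ¬_; yes; no; does; _×-dec_; ¬?)
open import Relation.Nullary.Decidable using (_→-dec_)
open import Algebra.Bundles using (CommutativeRing)
import Data.Fin.Properties as FinP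

-- Hypergraphs.
-- Vertex set V = Fin n.  The edge multiset E is given as a family of
-- subsets indexed by Fin r (each index is one occurrence of an edge).

Edges : ℕ → ℕ → Set
Edges n r = Fin r → Subset n

Uniform : ∀ {n r} → ℕ → Edges n r → Set
Uniform k E = ∀ e → ∣ E e ∣ ≡ k

_≟S_ : ∀ {n} (p q : Subset n) → Dec (p ≡ q)
_≟S_ = ≡-dec BoolP._≟_

-- Enumeration of the elements of a subset U in increasing order:
-- the i-th element of U.  Used to index the rows/columns of the
-- |U| x |U| Tutte matrix by U.
enum : ∀ {n} (U : Subset n) → Fin ∣ U ∣ → Fin n
enum (true  ∷ U) zero    = zero
enum (true  ∷ U) (suc i) = suc (enum U i)
enum (false ∷ U) i       = suc (enum U i)

incident : ∀ {n r} → Edges n r → Fin n → Subset r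
incident E a = tabulate (λ e → lookup (E e) a)

-- M is a set of edges (indices) such that every e ∈ M has nonempty
-- projection e ∩ U, and every vertex a ∈ U lies in exactly one e ∈ M
-- (equivalently: exactly one projection e ∩ U, e ∈ M, covers a).

IsPerfectMatching : ∀ {n r} → Edges n r → Subset n → Subset r → Set
IsPerfectMatching E U M =
  (∀ e → e ∈ M → ¬ (E e ∩ U ≡ ⊥)) ×
  (∀ a → a ∈ U → ∣ M ∩ incident E a ∣ ≡ 1)

isPerfectMatching? : ∀ {n r} (E : Edges n r) (U : Subset n) (M : Subset r) →
                     Dec (IsPerfectMatching E U M)
isPerfectMatching? E U M =
  FinP.all? (λ e → (e ∈? M) →-dec ¬? ((E e ∩ U) ≟S ⊥))
  ×-dec
  FinP.all? (λ a → (a ∈? U) →-dec (∣ M ∩ incident E a ∣ ℕ.≟ 1))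

IsLoop : ∀ {n r} → Edges n r → Subset n → Fin r → Set
IsLoop E U e = ∣ E e ∩ U ∣ ≡ 1

isLoop? : ∀ {n r} (E : Edges n r) (U : Subset n) (e : Fin r) → Dec (IsLoop E U e)
isLoop? E U e = ∣ E e ∩ U ∣ ℕ.≟ 1

loops : ∀ {n r} → Edges n r → Subset n → Subset r
loops E U = tabulate (λ e → does (isLoop? E U e))

Λ : ∀ {n r} → Edges n r → Subset n → Subset r → ℕ
Λ E U M = ∣ M ∩ loops E U ∣

module Over {c ℓ : Level} (R : CommutativeRing c ℓ) where
  open CommutativeRing R using (Carrier; _+_; _*_; -_; 0#; 1#)

  Σ[_] : ∀ r → (Fin r → Carrier) → Carrier
  Σ[ zero  ] f = 0#
  Σ[ suc r ] f = f zero + Σ[ r ] (λ i → f (suc i))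

  Π[_] : ∀ r → (Fin r → Carrier) → Carrier
  Π[ zero  ] f = 1#
  Π[ suc r ] f = f zero * Π[ r ] (λ i → f (suc i))

  _^_ : Carrier → ℕ → Carrier
  x ^ zero  = 1#
  x ^ suc k = x * (x ^ k)

  ΣSubsets : ∀ r → (Subset r → Carrier) → Carrier
  ΣSubsets zero    f = f []
  ΣSubsets (suc r) f = ΣSubsets r (λ p → f (outside ∷ p)) + ΣSubsets r (λ p → f (inside ∷ p))

  det : ∀ d → (Fin d → Fin d → Carrier) → Carrier
  det zero    A = 1#
  det (suc d) A = Σ[ suc d ] (λ j → ((- 1#) ^ toℕ j) * (A zero j * det d (λ i k → A (suc i) (punchIn j k))))

  Σedges : ∀ {n r} → Edges n r → Subset n → (Fin r → Carrier) → Subset n → Carrier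
  Σedges {r = r} E U v S = Σ[ r ] (λ e → if does ((E e ∩ U) ≟S S) then v e else 0#)

  tutte : ∀ {n r} → Edges n r → (U : Subset n) → Carrier → (Fin r → Carrier) →
          Fin ∣ U ∣ → Fin ∣ U ∣ → Carrier
  tutte E U s v i j =
    if does (i ≟ j)
    then s * Σedges E U v ⁅ enum U i ⁆
    else Σedges E U v (⁅ enum U i ⁆ ∪ ⁅ enum U j ⁆)

  p : ∀ {n r} → Edges n r → Subset n → Fin r → ℕ
  p E U e = if does (isLoop? E U e) then 1 else 2

  matchingSum : ∀ {n r} → Edges n r → Subset n → Carrier → (Fin r → Carrier) → Carrier
  matchingSum {r = r} E U s v =
    ΣSubsets r (λ M →
      if does (isPerfectMatching? E U M)
      then (s ^ Λ E U M) * Π[ r ] (λ e → if does (e ∈? M) then v e ^ p E U e else 1#)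
      else 0#)

CharTwo : ∀ {c ℓ} → CommutativeRing c ℓ → Set ℓ
CharTwo R = (1# + 1#) ≈ 0#
  where open CommutativeRing R using (_≈_; _+_; 0#; 1#)

module Submission where

-- In characteristic two the determinant is the permanent.  The Tutte matrix
-- T is symmetric, so a permutation and its inverse give equal terms, which
-- cancel unless the permutation is an involution: a fixed point a weighs
-- T_aa = s·Σ_{e ∩ U = {a}} v_e, a 2-cycle {a, b} weighs T_ab² = Σ_{e ∩ U = {a,b}} v_e²
-- (squaring is additive).  Distributing these products over the edges gives
-- the sum over the partitions of U into traces e ∩ U, i.e. over the perfect
-- matchings.

open import Defs
open import Data.Nat using (ℕ; _≤_)
open import Data.Fin using (Fin)
open import Data.Fin.Subset using (Subset; _∩_; ∣_∣)
open import Algebra.Bundles using (CommutativeRing)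

open import Data.Bool using (Bool; true; false; if_then_else_; _∧_; _∨_; not)
open import Data.Bool.Properties using (∧-zeroʳ; ∧-identityʳ; ∧-assoc; ∨-zeroʳ; not-injective)
open import Data.Nat as ℕ using (zero; suc; z≤n; s≤s)
import Data.Nat.Properties as ℕ
open import Data.Fin as Fin using (zero; suc; _≟_)
open import Data.Fin.Subset using (_∪_; _─_; _-_; ⁅_⁆; ⊥)
open import Data.Fin.Subset.Properties
  using (∩-comm; ∩-idem; ∪-identityˡ; ∪-identityʳ; ∣⁅x⁆∣≡1)
open import Data.Vec using ([]; _∷_; lookup)
open import Data.Vec.Properties using (lookup-zipWith; lookup-replicate; []=⇒lookup; lookup⇒[]=)
open import Data.Product using (Σ-syntax; _×_; _,_; proj₁; proj₂)
open import Data.Sum using (_⊎_; inj₁; inj₂)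
open import Data.Empty using (⊥-elim)
open import Relation.Nullary using (does; yes; no)
open import Relation.Nullary.Decidable using (dec-true; dec-false; does-⇔; T?)
open import Relation.Binary.PropositionalEquality as ≡ using (_≡_; _≢_)
open import Function using (_∘_; case_of_)
import Relation.Binary.Reasoning.Setoid

module SubsetTests where

  open ≡ using (refl; sym; trans; cong; cong₂; subst)

  private variable m : ℕ

  infix 7 _⊆ᵇ_

  _⊆ᵇ_ : Subset m → Subset m → Bool
  []      ⊆ᵇ []      = true
  (x ∷ P) ⊆ᵇ (y ∷ Q) = (not x ∨ y) ∧ (P ⊆ᵇ Q)

  nonemptyᵇ : Subset m → Bool
  nonemptyᵇ []      = false
  nonemptyᵇ (x ∷ P) = x ∨ nonemptyᵇ P

  disjointᵇ : Subset m → Subset m → Bool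
  disjointᵇ P Q = not (nonemptyᵇ (P ∩ Q))

  fitsᵇ : Subset m → Subset m → Bool
  fitsᵇ P W = nonemptyᵇ P ∧ (P ⊆ᵇ W)

  blockAtᵇ : Fin m → Subset m → Subset m → Bool
  blockAtᵇ a P W = lookup P a ∧ (P ⊆ᵇ W)

  lookup-─ : ∀ (a : Fin m) W P → lookup (W ─ P) a ≡ lookup W a ∧ not (lookup P a)
  lookup-─ zero    (w ∷ W) (true  ∷ P) = sym (∧-zeroʳ w)
  lookup-─ zero    (w ∷ W) (false ∷ P) = sym (∧-identityʳ w)
  lookup-─ (suc a) (w ∷ W) (x     ∷ P) = lookup-─ a W P

  ∈-─⁻ : ∀ W P {a : Fin m} → lookup (W ─ P) a ≡ true → lookup W a ≡ true × lookup P a ≡ false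
  ∈-─⁻ W P {a} a∈W─P with lookup W a | lookup P a | trans (sym (lookup-─ a W P)) a∈W─P
  ... | true | false | _ = refl , refl

  ∈-─⁺ : ∀ W P {a : Fin m} → lookup W a ≡ true → lookup P a ≡ false → lookup (W ─ P) a ≡ true
  ∈-─⁺ W P {a} a∈W a∉P = trans (lookup-─ a W P) (cong₂ (λ x y → x ∧ not y) a∈W a∉P)

  lookup-⁅⁆ : ∀ (c b : Fin m) → lookup ⁅ c ⁆ b ≡ does (c ≟ b)
  lookup-⁅⁆ zero    zero    = refl
  lookup-⁅⁆ zero    (suc b) = lookup-replicate b false
  lookup-⁅⁆ (suc c) zero    = refl
  lookup-⁅⁆ (suc c) (suc b) = lookup-⁅⁆ c b

  a∈⁅a⁆ : ∀ (a : Fin m) → lookup ⁅ a ⁆ a ≡ true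
  a∈⁅a⁆ a = trans (lookup-⁅⁆ a a) (dec-true (a ≟ a) refl)

  ≢⇒∉⁅⁆ : ∀ {a b : Fin m} → a ≢ b → lookup ⁅ a ⁆ b ≡ false
  ≢⇒∉⁅⁆ {a = a} {b} a≢b = trans (lookup-⁅⁆ a b) (dec-false (a ≟ b) a≢b)

  ∉⁅⁆⇒≢ : ∀ (a b : Fin m) → lookup ⁅ a ⁆ b ≡ false → a ≢ b
  ∉⁅⁆⇒≢ a b b∉a refl = case trans (sym b∉a) (a∈⁅a⁆ a) of λ ()

  lookup-remove : ∀ W (c b : Fin m) → lookup (W - c) b ≡ lookup W b ∧ not (does (c ≟ b))
  lookup-remove W c b = trans (lookup-─ b W ⁅ c ⁆) (cong (λ x → lookup W b ∧ not x) (lookup-⁅⁆ c b))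

  ∧-trueˡ : ∀ {x y} → x ∧ y ≡ true → x ≡ true
  ∧-trueˡ {true} _ = refl

  ∧-trueʳ : ∀ {x y} → x ∧ y ≡ true → y ≡ true
  ∧-trueʳ {true} y≡true = y≡true

  ∣∷∣ : ∀ b (P : Subset m) → ∣ b ∷ P ∣ ≡ (if b then 1 else 0) ℕ.+ ∣ P ∣
  ∣∷∣ true  P = refl
  ∣∷∣ false P = refl

  ⊆ᵇ-sound : ∀ (P Q : Subset m) {x} → P ⊆ᵇ Q ≡ true → lookup P x ≡ true → lookup Q x ≡ true
  ⊆ᵇ-sound (true  ∷ P) (true ∷ Q) {zero}  P⊆Q x∈P = refl
  ⊆ᵇ-sound (true  ∷ P) (y    ∷ Q) {suc x} P⊆Q x∈P = ⊆ᵇ-sound P Q (∧-trueʳ P⊆Q) x∈P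
  ⊆ᵇ-sound (false ∷ P) (y    ∷ Q) {suc x} P⊆Q x∈P = ⊆ᵇ-sound P Q P⊆Q x∈P

  ⊆ᵇ-complete : ∀ (P Q : Subset m) → (∀ x → lookup P x ≡ true → lookup Q x ≡ true) → P ⊆ᵇ Q ≡ true
  ⊆ᵇ-complete []          []      P⊆Q = refl
  ⊆ᵇ-complete (true  ∷ P) (y ∷ Q) P⊆Q
    rewrite P⊆Q zero refl = ⊆ᵇ-complete P Q (λ x → P⊆Q (suc x))
  ⊆ᵇ-complete (false ∷ P) (y ∷ Q) P⊆Q = ⊆ᵇ-complete P Q (λ x → P⊆Q (suc x))

  nonemptyᵇ-∈ : ∀ (P : Subset m) {x} → lookup P x ≡ true → nonemptyᵇ P ≡ true
  nonemptyᵇ-∈ (true  ∷ P)          x∈P = refl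
  nonemptyᵇ-∈ (false ∷ P) {suc x} x∈P = nonemptyᵇ-∈ P x∈P

  nonemptyᵇ-witness : ∀ (P : Subset m) → nonemptyᵇ P ≡ true → Σ[ x ∈ Fin m ] lookup P x ≡ true
  nonemptyᵇ-witness (true  ∷ P) _  = zero , refl
  nonemptyᵇ-witness (false ∷ P) ne = let x , x∈P = nonemptyᵇ-witness P ne in suc x , x∈P

  nonemptyᵇ-false : ∀ (P : Subset m) → nonemptyᵇ P ≡ false → P ≡ ⊥
  nonemptyᵇ-false []          _  = refl
  nonemptyᵇ-false (false ∷ P) ne = cong (false ∷_) (nonemptyᵇ-false P ne)

  nonemptyᵇ-⊥ : ∀ m → nonemptyᵇ (⊥ {m}) ≡ false
  nonemptyᵇ-⊥ zero    = refl
  nonemptyᵇ-⊥ (suc m) = nonemptyᵇ-⊥ m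

  disjointᵇ-shared : ∀ (P Q : Subset m) {x} → lookup P x ≡ true → lookup Q x ≡ true →
                     disjointᵇ P Q ≡ false
  disjointᵇ-shared P Q {x} x∈P x∈Q = cong not (nonemptyᵇ-∈ (P ∩ Q)
    (trans (lookup-zipWith _∧_ x P Q) (cong₂ _∧_ x∈P x∈Q)))

  disjointᵇ-witness : ∀ (P Q : Subset m) → disjointᵇ P Q ≡ false →
                      Σ[ x ∈ Fin m ] lookup P x ≡ true × lookup Q x ≡ true
  disjointᵇ-witness P Q dj =
    let x , x∈P∩Q = nonemptyᵇ-witness (P ∩ Q) (not-injective dj)
        x∈P∧x∈Q  = trans (sym (lookup-zipWith _∧_ x P Q)) x∈P∩Q
    in  x , ∧-trueˡ x∈P∧x∈Q , ∧-trueʳ x∈P∧x∈Q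

  disjointᵇ-comm : ∀ (P Q : Subset m) → disjointᵇ P Q ≡ disjointᵇ Q P
  disjointᵇ-comm P Q = cong (λ V → not (nonemptyᵇ V)) (∩-comm P Q)

  ⊆ᵇ-─ : ∀ (Q W P : Subset m) → Q ⊆ᵇ (W ─ P) ≡ (Q ⊆ᵇ W) ∧ disjointᵇ Q P
  ⊆ᵇ-─ []          []      []          = refl
  ⊆ᵇ-─ (false ∷ Q) (w ∷ W) (y     ∷ P) = ⊆ᵇ-─ Q W P
  ⊆ᵇ-─ (true  ∷ Q) (w ∷ W) (true  ∷ P) = sym (∧-zeroʳ (w ∧ (Q ⊆ᵇ W)))
  ⊆ᵇ-─ (true  ∷ Q) (w ∷ W) (false ∷ P) =
    trans (cong (w ∧_) (⊆ᵇ-─ Q W P)) (sym (∧-assoc w (Q ⊆ᵇ W) (disjointᵇ Q P)))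

  fitsᵇ-─ : ∀ (Q W P : Subset m) → fitsᵇ Q (W ─ P) ≡ fitsᵇ Q W ∧ disjointᵇ Q P
  fitsᵇ-─ Q W P = trans (cong (nonemptyᵇ Q ∧_) (⊆ᵇ-─ Q W P)) (sym (∧-assoc (nonemptyᵇ Q) _ _))

  fitsᵇ-─-self : ∀ (P W : Subset m) → fitsᵇ P (W ─ P) ≡ false
  fitsᵇ-─-self P W rewrite fitsᵇ-─ P W P | ∩-idem P with nonemptyᵇ P
  ... | true  = ∧-zeroʳ (true ∧ (P ⊆ᵇ W))
  ... | false = refl

  fitsᵇ-⊥ : ∀ (P : Subset m) → fitsᵇ P ⊥ ≡ false
  fitsᵇ-⊥ []          = refl
  fitsᵇ-⊥ (true  ∷ P) = refl
  fitsᵇ-⊥ (false ∷ P) = fitsᵇ-⊥ P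

  subset-ext : ∀ (P Q : Subset m) → (∀ x → lookup P x ≡ lookup Q x) → P ≡ Q
  subset-ext []      []      _   = refl
  subset-ext (x ∷ P) (y ∷ Q) P≗Q = cong₂ _∷_ (P≗Q zero) (subset-ext P Q (λ i → P≗Q (suc i)))

  ⊆ᵇ-∣∣ : ∀ (P Q : Subset m) → P ⊆ᵇ Q ≡ true → ∣ P ∣ ≤ ∣ Q ∣
  ⊆ᵇ-∣∣ []          []          _   = z≤n
  ⊆ᵇ-∣∣ (true  ∷ P) (true  ∷ Q) P⊆Q = s≤s (⊆ᵇ-∣∣ P Q P⊆Q)
  ⊆ᵇ-∣∣ (false ∷ P) (true  ∷ Q) P⊆Q = ℕ.m≤n⇒m≤1+n (⊆ᵇ-∣∣ P Q P⊆Q)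
  ⊆ᵇ-∣∣ (false ∷ P) (false ∷ Q) P⊆Q = ⊆ᵇ-∣∣ P Q P⊆Q

  ⊆ᵇ-∣∣-≡ : ∀ (P Q : Subset m) → P ⊆ᵇ Q ≡ true → ∣ Q ∣ ≤ ∣ P ∣ → P ≡ Q
  ⊆ᵇ-∣∣-≡ []          []          _   _         = refl
  ⊆ᵇ-∣∣-≡ (true  ∷ P) (true  ∷ Q) P⊆Q (s≤s Q≤P) = cong (true ∷_) (⊆ᵇ-∣∣-≡ P Q P⊆Q Q≤P)
  ⊆ᵇ-∣∣-≡ (false ∷ P) (false ∷ Q) P⊆Q Q≤P       = cong (false ∷_) (⊆ᵇ-∣∣-≡ P Q P⊆Q Q≤P)
  ⊆ᵇ-∣∣-≡ (false ∷ P) (true  ∷ Q) P⊆Q Q≤P       =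
    ⊥-elim (ℕ.<-irrefl refl (ℕ.≤-trans Q≤P (⊆ᵇ-∣∣ P Q P⊆Q)))

  only-element : ∀ (Q : Subset m) a → lookup Q a ≡ true → Q - a ≡ ⊥ → Q ≡ ⁅ a ⁆
  only-element Q a a∈Q Q-a≡⊥ = subset-ext Q ⁅ a ⁆ same
    where
    same : ∀ y → lookup Q y ≡ lookup ⁅ a ⁆ y
    same y with a ≟ y
    ... | yes refl = trans a∈Q (sym (a∈⁅a⁆ a))
    ... | no a≢y = begin
      lookup Q y                                ≡⟨ ∧-identityʳ (lookup Q y) ⟨
      lookup Q y ∧ not false                    ≡⟨ cong (λ t → lookup Q y ∧ not t) (dec-false (a ≟ y) a≢y) ⟨
      lookup Q y ∧ not (does (a ≟ y))           ≡⟨ lookup-remove Q a y ⟨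
      lookup (Q - a) y                          ≡⟨ cong (λ V → lookup V y) Q-a≡⊥ ⟩
      lookup ⊥ y                                ≡⟨ lookup-replicate y false ⟩
      false                                     ≡⟨ dec-false (a ≟ y) a≢y ⟨
      does (a ≟ y)                              ≡⟨ lookup-⁅⁆ a y ⟨
      lookup ⁅ a ⁆ y                            ∎
      where open ≡.≡-Reasoning

  lookup-pair : ∀ (a b x : Fin m) → lookup (⁅ a ⁆ ∪ ⁅ b ⁆) x ≡ does (a ≟ x) ∨ does (b ≟ x)
  lookup-pair a b x = trans (lookup-zipWith _∨_ x ⁅ a ⁆ ⁅ b ⁆) (cong₂ _∨_ (lookup-⁅⁆ a x) (lookup-⁅⁆ b x))

  ∈⁅⁆⁻ : ∀ (a y : Fin m) → lookup ⁅ a ⁆ y ≡ true → a ≡ y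
  ∈⁅⁆⁻ a y y∈a with a ≟ y | trans (sym (lookup-⁅⁆ a y)) y∈a
  ... | yes a≡y | _ = a≡y

  ∈pair⁻ : ∀ (a b y : Fin m) → lookup (⁅ a ⁆ ∪ ⁅ b ⁆) y ≡ true → a ≡ y ⊎ b ≡ y
  ∈pair⁻ a b y y∈pair with a ≟ y | b ≟ y | trans (sym (lookup-pair a b y)) y∈pair
  ... | yes a≡y | _       | _ = inj₁ a≡y
  ... | no _    | yes b≡y | _ = inj₂ b≡y

  ∣pair∣ : ∀ {a b : Fin m} → a ≢ b → ∣ ⁅ a ⁆ ∪ ⁅ b ⁆ ∣ ≡ 2
  ∣pair∣ {a = zero}  {zero}  a≢b = ⊥-elim (a≢b refl)
  ∣pair∣ {a = zero}  {suc b} a≢b = cong suc (trans (cong ∣_∣ (∪-identityˡ ⁅ b ⁆)) (∣⁅x⁆∣≡1 b))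
  ∣pair∣ {a = suc a} {zero}  a≢b = cong suc (trans (cong ∣_∣ (∪-identityʳ ⁅ a ⁆)) (∣⁅x⁆∣≡1 a))
  ∣pair∣ {a = suc a} {suc b} a≢b = ∣pair∣ (a≢b ∘ cong suc)

  ⁅⁆⊆ : ∀ {a : Fin m} (Q : Subset m) → lookup Q a ≡ true → ⁅ a ⁆ ⊆ᵇ Q ≡ true
  ⁅⁆⊆ {a = a} Q a∈Q = ⊆ᵇ-complete ⁅ a ⁆ Q (λ y y∈a → subst (λ z → lookup Q z ≡ true) (∈⁅⁆⁻ a y y∈a) a∈Q)

  pair⊆ : ∀ {a b : Fin m} (Q : Subset m) → lookup Q a ≡ true → lookup Q b ≡ true →
          (⁅ a ⁆ ∪ ⁅ b ⁆) ⊆ᵇ Q ≡ true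
  pair⊆ {a = a} {b} Q a∈Q b∈Q = ⊆ᵇ-complete (⁅ a ⁆ ∪ ⁅ b ⁆) Q pair⊆Q
    where
    pair⊆Q : ∀ x → lookup (⁅ a ⁆ ∪ ⁅ b ⁆) x ≡ true → lookup Q x ≡ true
    pair⊆Q x x∈pair with ∈pair⁻ a b x x∈pair
    ... | inj₁ refl = a∈Q
    ... | inj₂ refl = b∈Q

  pair-unique : ∀ {a b : Fin m} (Q : Subset m) → a ≢ b → lookup Q a ≡ true → lookup Q b ≡ true →
                ∣ Q ∣ ≤ 2 → ⁅ a ⁆ ∪ ⁅ b ⁆ ≡ Q
  pair-unique {a = a} {b} Q a≢b a∈Q b∈Q ∣Q∣≤2 =
    ⊆ᵇ-∣∣-≡ (⁅ a ⁆ ∪ ⁅ b ⁆) Q (pair⊆ Q a∈Q b∈Q) (subst (∣ Q ∣ ≤_) (sym (∣pair∣ a≢b)) ∣Q∣≤2)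

  a∈pair : ∀ (a b : Fin m) → lookup (⁅ a ⁆ ∪ ⁅ b ⁆) a ≡ true
  a∈pair a b = trans (lookup-pair a b a) (cong (_∨ does (b ≟ a)) (dec-true (a ≟ a) refl))

  b∈pair : ∀ (a b : Fin m) → lookup (⁅ a ⁆ ∪ ⁅ b ⁆) b ≡ true
  b∈pair a b = trans (lookup-pair a b b) (trans (cong (does (a ≟ b) ∨_) (dec-true (b ≟ b) refl)) (∨-zeroʳ _))

  pair≟pair : ∀ {a b b′ : Fin m} → a ≢ b →
              does ((⁅ a ⁆ ∪ ⁅ b ⁆) ≟S (⁅ a ⁆ ∪ ⁅ b′ ⁆)) ≡ does (b ≟ b′)
  pair≟pair {a = a} {b} {b′} a≢b with b ≟ b′
  ... | yes refl = dec-true ((⁅ a ⁆ ∪ ⁅ b ⁆) ≟S (⁅ a ⁆ ∪ ⁅ b ⁆)) refl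
  ... | no  b≢b′ = dec-false ((⁅ a ⁆ ∪ ⁅ b ⁆) ≟S (⁅ a ⁆ ∪ ⁅ b′ ⁆))
                              (λ pairs≡ → b≢b′ (sym (second pairs≡)))
    where
    second : ⁅ a ⁆ ∪ ⁅ b ⁆ ≡ ⁅ a ⁆ ∪ ⁅ b′ ⁆ → b′ ≡ b
    second pairs≡ with a ≟ b | b′ ≟ b
                     | trans (sym (b∈pair a b)) (trans (cong (λ V → lookup V b) pairs≡) (lookup-pair a b′ b))
    ... | yes a≡b | _        | _  = ⊥-elim (a≢b a≡b)
    ... | no _    | yes b′≡b | _  = b′≡b
    ... | no _    | no _     | ()

  singleton≢pair : ∀ {a b : Fin m} → a ≢ b → does (⁅ a ⁆ ≟S (⁅ a ⁆ ∪ ⁅ b ⁆)) ≡ false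
  singleton≢pair {a = a} {b} a≢b = dec-false (⁅ a ⁆ ≟S (⁅ a ⁆ ∪ ⁅ b ⁆)) λ single≡pair →
    case trans (sym (≢⇒∉⁅⁆ a≢b))
               (trans (cong (λ V → lookup V b) single≡pair) (b∈pair a b)) of
      λ ()

module Enumerations where

  open SubsetTests
  open ≡ using (refl; sym; trans; cong; subst)
  open import Data.Fin.Subset.Properties using (p─x─y≡p─y─x; p─⊥≡p)
  open import Data.Vec.Functional using (removeAt)

  private variable m : ℕ

  Enumerates : ∀ {d} → (Fin d → Fin m) → Subset m → Set
  Enumerates {d = zero}  S W = W ≡ ⊥
  Enumerates {d = suc d} S W = lookup W (S zero) ≡ true × Enumerates (S ∘ suc) (W - S zero)

  Enumerates-removeAt : ∀ {d} (S : Fin (suc d) → Fin m) W → Enumerates S W →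
                        ∀ j → lookup W (S j) ≡ true × Enumerates (removeAt S j) (W - S j)
  Enumerates-removeAt S W S-enum zero = S-enum
  Enumerates-removeAt {d = suc d} S W (S₀∈W , rest-enum) (suc j) =
    proj₁ (∈-─⁻ W ⁅ S zero ⁆ Sⱼ∈W−S₀) ,
    ∈-─⁺ W ⁅ S (suc j) ⁆ S₀∈W (≢⇒∉⁅⁆ Sⱼ≢S₀) ,
    subst (Enumerates (removeAt (S ∘ suc) j)) (p─x─y≡p─y─x W (S zero) (S (suc j))) rest
    where
    Sⱼ∈W−S₀ : lookup (W - S zero) (S (suc j)) ≡ true
    Sⱼ∈W−S₀ = proj₁ (Enumerates-removeAt (S ∘ suc) (W - S zero) rest-enum j)
    rest : Enumerates (removeAt (S ∘ suc) j) (W - S zero - S (suc j))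
    rest = proj₂ (Enumerates-removeAt (S ∘ suc) (W - S zero) rest-enum j)
    Sⱼ≢S₀ : S (suc j) ≢ S zero
    Sⱼ≢S₀ = ∉⁅⁆⇒≢ (S zero) (S (suc j)) (proj₂ (∈-─⁻ W ⁅ S zero ⁆ Sⱼ∈W−S₀)) ∘ sym

  Enumerates-∈ : ∀ {d} (S : Fin d → Fin m) W → Enumerates S W → ∀ j → lookup W (S j) ≡ true
  Enumerates-∈ {d = suc d} S W S-enum j = proj₁ (Enumerates-removeAt S W S-enum j)

  Enumerates-suc : ∀ {d} (S : Fin d → Fin m) W → Enumerates S W → Enumerates (suc ∘ S) (false ∷ W)
  Enumerates-suc {d = zero}  S W W≡⊥           = cong (false ∷_) W≡⊥
  Enumerates-suc {d = suc d} S W (S₀∈W , rest) = S₀∈W , Enumerates-suc (S ∘ suc) (W - S zero) rest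

  Enumerates-enum : ∀ (U : Subset m) → Enumerates (enum U) U
  Enumerates-enum []          = refl
  Enumerates-enum (true  ∷ U) =
    refl , subst (λ V → Enumerates (suc ∘ enum U) (false ∷ V)) (sym (p─⊥≡p U))
                 (Enumerates-suc (enum U) U (Enumerates-enum U))
  Enumerates-enum (false ∷ U) = Enumerates-suc (enum U) U (Enumerates-enum U)

module CharTwoSums {c ℓ} (R : CommutativeRing c ℓ) (char2 : CharTwo R) where

  open CommutativeRing R hiding (zero)
  open Over R using (Σ[_]; _^_; ΣSubsets)
  open import Algebra.Properties.Semiring.Sum semiring public
    using (sum; sum-cong-≋; sum-cong-≗; ∑-distrib-+; ∑-comm; *-distribˡ-sum; *-distribʳ-sum;
           sum-replicate-zero)
  open import Algebra.Properties.CommutativeSemigroup *-commutativeSemigroup public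
    using () renaming (x∙yz≈y∙xz to x*[y*z]≈y*[x*z])
  open import Algebra.Properties.CommutativeSemigroup +-commutativeSemigroup public
    using () renaming (x∙yz≈y∙xz to x+[y+z]≈y+[x+z])
  open import Relation.Binary.Reasoning.Setoid setoid

  x+x≈0 : ∀ x → x + x ≈ 0#
  x+x≈0 x = begin
    x + x               ≈⟨ +-cong (*-identityˡ x) (*-identityˡ x) ⟨
    1# * x + 1# * x     ≈⟨ distribʳ x 1# 1# ⟨
    (1# + 1#) * x       ≈⟨ *-congʳ char2 ⟩
    0# * x              ≈⟨ zeroˡ x ⟩
    0#                  ∎

  -x≈x : ∀ x → - x ≈ x
  -x≈x x = begin
    - x                 ≈⟨ +-identityʳ (- x) ⟨
    - x + 0#            ≈⟨ +-congˡ (x+x≈0 x) ⟨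
    - x + (x + x)       ≈⟨ +-assoc (- x) x x ⟨
    (- x + x) + x       ≈⟨ +-congʳ (-‿inverseˡ x) ⟩
    0# + x              ≈⟨ +-identityˡ x ⟩
    x                   ∎

  -1^k≈1 : ∀ k → (- 1#) ^ k ≈ 1#
  -1^k≈1 zero    = refl
  -1^k≈1 (suc k) = trans (*-cong (-x≈x 1#) (-1^k≈1 k)) (*-identityˡ 1#)

  square-+ : ∀ x y → (x + y) * (x + y) ≈ x * x + y * y
  square-+ x y = begin
    (x + y) * (x + y)                   ≈⟨ distribʳ _ _ _ ⟩
    x * (x + y) + y * (x + y)           ≈⟨ +-cong (distribˡ _ _ _) (distribˡ _ _ _) ⟩
    (x * x + x * y) + (y * x + y * y)   ≈⟨ +-congˡ (+-congʳ (*-comm y x)) ⟩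
    (x * x + x * y) + (x * y + y * y)   ≈⟨ +-assoc _ _ _ ⟩
    x * x + (x * y + (x * y + y * y))   ≈⟨ +-congˡ (+-assoc _ _ _) ⟨
    x * x + ((x * y + x * y) + y * y)   ≈⟨ +-congˡ (+-congʳ (x+x≈0 _)) ⟩
    x * x + (0# + y * y)                ≈⟨ +-congˡ (+-identityˡ _) ⟩
    x * x + y * y                       ∎

  square-sum : ∀ {d} (f : Fin d → Carrier) → sum f * sum f ≈ sum (λ i → f i * f i)
  square-sum {zero}  f = zeroˡ 0#
  square-sum {suc d} f = trans (square-+ _ _) (+-congˡ (square-sum (λ i → f (suc i))))

  -- A symmetric double sum equals its diagonal: the terms F i j and F j i cancel.
  sum-symmetric : ∀ {d} (F : Fin d → Fin d → Carrier) → (∀ i j → F i j ≈ F j i) →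
                  sum (λ i → sum (F i)) ≈ sum (λ i → F i i)
  sum-symmetric {zero}  F F-sym = refl
  sum-symmetric {suc d} F F-sym = begin
    (F₀₀ + row) + sum (λ i → F (suc i) zero + sum (λ j → F (suc i) (suc j)))
      ≈⟨ +-congˡ (∑-distrib-+ (λ i → F (suc i) zero) _) ⟩
    (F₀₀ + row) + (col + sum (λ i → sum (λ j → F (suc i) (suc j))))
      ≈⟨ +-cong (+-congˡ (sum-cong-≋ (λ j → F-sym zero (suc j))))
                (+-congˡ (sum-symmetric (λ i j → F (suc i) (suc j)) (λ i j → F-sym (suc i) (suc j)))) ⟩
    (F₀₀ + col) + (col + diag)      ≈⟨ +-assoc _ _ _ ⟩
    F₀₀ + (col + (col + diag))      ≈⟨ +-congˡ (+-assoc _ _ _) ⟨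
    F₀₀ + ((col + col) + diag)      ≈⟨ +-congˡ (+-congʳ (x+x≈0 col)) ⟩
    F₀₀ + (0# + diag)               ≈⟨ +-congˡ (+-identityˡ diag) ⟩
    F₀₀ + diag                      ∎
    where
    F₀₀ row col diag : Carrier
    F₀₀  = F zero zero
    row  = sum (λ j → F zero (suc j))
    col  = sum (λ i → F (suc i) zero)
    diag = sum (λ i → F (suc i) (suc i))

  sum-zero : ∀ {d} {f : Fin d → Carrier} → (∀ i → f i ≈ 0#) → sum f ≈ 0#
  sum-zero {d} f≈0 = trans (sum-cong-≋ f≈0) (sum-replicate-zero d)

  Σ≡sum : ∀ d (f : Fin d → Carrier) → Σ[ d ] f ≡ sum f
  Σ≡sum zero    f = ≡.refl
  Σ≡sum (suc d) f = ≡.cong (f zero +_) (Σ≡sum d (λ i → f (suc i)))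

  ΣSubsets-cong : ∀ r {f g : Subset r → Carrier} → (∀ M → f M ≈ g M) →
                  ΣSubsets r f ≈ ΣSubsets r g
  ΣSubsets-cong zero    f≈g = f≈g []
  ΣSubsets-cong (suc r) f≈g =
    +-cong (ΣSubsets-cong r (λ M → f≈g (false ∷ M))) (ΣSubsets-cong r (λ M → f≈g (true ∷ M)))

  ΣSubsets-* : ∀ r x (f : Subset r → Carrier) → ΣSubsets r (λ M → x * f M) ≈ x * ΣSubsets r f
  ΣSubsets-* zero    x f = refl
  ΣSubsets-* (suc r) x f = trans (+-cong (ΣSubsets-* r x _) (ΣSubsets-* r x _)) (sym (distribˡ _ _ _))

  ΣSubsets-0 : ∀ r → ΣSubsets r (λ _ → 0#) ≈ 0#
  ΣSubsets-0 zero    = refl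
  ΣSubsets-0 (suc r) = trans (+-cong (ΣSubsets-0 r) (ΣSubsets-0 r)) (+-identityˡ 0#)

-- Matrices are functions A : X → X → R
-- on an index type X; a d × d submatrix is selected by a row vector
-- ρ and a column vector γ of indices.
module Permanents {c ℓ} (R : CommutativeRing c ℓ) (char2 : CharTwo R) {X : Set} where

  open CommutativeRing R hiding (zero)
  open Over R using (det; _^_)
  open CharTwoSums R char2
  open import Data.Vec.Functional using (head; tail; removeAt)
  open import Function using (flip)
  open import Relation.Binary.Reasoning.Setoid setoid

  perm : ∀ {d} → (X → X → Carrier) → (Fin d → X) → (Fin d → X) → Carrier
  perm {zero}  A ρ γ = 1#
  perm {suc d} A ρ γ = sum (λ j → A (head ρ) (γ j) * perm A (tail ρ) (removeAt γ j))

  perm-cong : ∀ {d} {A B : X → X → Carrier} → (∀ x y → A x y ≈ B x y) →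
              (ρ γ : Fin d → X) → perm A ρ γ ≈ perm B ρ γ
  perm-cong {zero}  A≈B ρ γ = refl
  perm-cong {suc d} A≈B ρ γ =
    sum-cong-≋ (λ j → *-cong (A≈B (head ρ) (γ j)) (perm-cong A≈B (tail ρ) (removeAt γ j)))

  det≈perm : ∀ d (M : Fin d → Fin d → Carrier) (A : X → X → Carrier) (ρ γ : Fin d → X) →
             (∀ i k → M i k ≈ A (ρ i) (γ k)) → det d M ≈ perm A ρ γ
  det≈perm zero    M A ρ γ M≈A = refl
  det≈perm (suc d) M A ρ γ M≈A = begin
    Σ[ suc d ] (λ j → ((- 1#) ^ Fin.toℕ j) * expand j)
      ≡⟨ Σ≡sum (suc d) (λ j → ((- 1#) ^ Fin.toℕ j) * expand j) ⟩
    sum (λ j → ((- 1#) ^ Fin.toℕ j) * expand j)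
      ≈⟨ sum-cong-≋ (λ j → trans (*-congʳ (-1^k≈1 (Fin.toℕ j))) (*-identityˡ (expand j))) ⟩
    sum expand
      ≈⟨ sum-cong-≋ (λ j → *-cong (M≈A zero j)
           (det≈perm d (minor j) A (tail ρ) (removeAt γ j) (λ i k → M≈A (suc i) _))) ⟩
    perm A ρ γ ∎
    where
    open Over R using (Σ[_])
    minor : Fin (suc d) → Fin d → Fin d → Carrier
    minor j i k = M (suc i) (Fin.punchIn j k)
    expand : Fin (suc d) → Carrier
    expand j = M zero j * det d (minor j)

  perm-column : ∀ {d} (A : X → X → Carrier) (ρ γ : Fin (suc d) → X) →
                perm A ρ γ ≈ sum (λ i → A (ρ i) (head γ) * perm A (removeAt ρ i) (tail γ))
  perm-column {zero}  A ρ γ = refl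
  perm-column {suc d} A ρ γ = +-congˡ (begin
    sum (λ j → A ρ₀ (γ′ j) * perm A ρ′ (removeAt γ (suc j)))
      ≈⟨ sum-cong-≋ (λ j → *-congˡ {A ρ₀ (γ′ j)} (perm-column A ρ′ (removeAt γ (suc j)))) ⟩
    sum (λ j → A ρ₀ (γ′ j) * sum (λ i → A (ρ′ i) γ₀ * P i j))
      ≈⟨ sum-cong-≋ (λ j → *-distribˡ-sum (A ρ₀ (γ′ j)) (λ i → A (ρ′ i) γ₀ * P i j)) ⟩
    sum (λ j → sum (λ i → A ρ₀ (γ′ j) * (A (ρ′ i) γ₀ * P i j)))
      ≈⟨ ∑-comm (λ j i → A ρ₀ (γ′ j) * (A (ρ′ i) γ₀ * P i j)) ⟩
    sum (λ i → sum (λ j → A ρ₀ (γ′ j) * (A (ρ′ i) γ₀ * P i j)))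
      ≈⟨ sum-cong-≋ (λ i → sum-cong-≋ (λ j → x*[y*z]≈y*[x*z] (A ρ₀ (γ′ j)) (A (ρ′ i) γ₀) (P i j))) ⟩
    sum (λ i → sum (λ j → A (ρ′ i) γ₀ * (A ρ₀ (γ′ j) * P i j)))
      ≈⟨ sum-cong-≋ (λ i → *-distribˡ-sum (A (ρ′ i) γ₀) (λ j → A ρ₀ (γ′ j) * P i j)) ⟨
    sum (λ i → A (ρ′ i) γ₀ * perm A (removeAt ρ (suc i)) γ′) ∎)
    where
    ρ₀ γ₀ : X
    ρ₀ = head ρ
    γ₀ = head γ
    ρ′ γ′ : Fin (suc d) → X
    ρ′ = tail ρ
    γ′ = tail γ
    -- the minor without row 0, row suc i, column 0 and column suc j
    P : Fin (suc d) → Fin (suc d) → Carrier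
    P i j = perm A (removeAt ρ′ i) (removeAt γ′ j)

  perm-transpose : ∀ {d} (A : X → X → Carrier) (ρ γ : Fin d → X) → perm A ρ γ ≈ perm (flip A) γ ρ
  perm-transpose {zero}  A ρ γ = refl
  perm-transpose {suc d} A ρ γ = trans (perm-column A ρ γ)
    (sum-cong-≋ (λ i → *-congˡ {A (ρ i) (head γ)} (perm-transpose A (removeAt ρ i) (tail γ))))

  perm-symmetric : ∀ {d} {A : X → X → Carrier} → (∀ x y → A x y ≈ A y x) →
                   (ρ γ : Fin d → X) → perm A ρ γ ≈ perm A γ ρ
  perm-symmetric {A = A} A-sym ρ γ =
    trans (perm-transpose A ρ γ) (perm-cong (λ x y → A-sym y x) γ ρ)

  -- The weighted sum over the involutions of the positions of S: the
  -- first position is either fixed (weight A a a) or exchanged with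
  -- the j-th remaining position (weight (A a b)², as both entries
  -- A a b and A b a occur).
  module _ (A : X → X → Carrier) where
    mutual
      invSum : ∀ {d} → (Fin d → X) → Carrier
      invSum {zero}  S = 1#
      invSum {suc d} S = A (head S) (head S) * invSum (tail S) + pairSum (head S) (tail S)

      pairSum : X → ∀ {d} → (Fin d → X) → Carrier
      pairSum a {zero}  T = 0#
      pairSum a {suc d} T = sum (λ j → (A a (T j) * A a (T j)) * invSum (removeAt T j))

  -- For a symmetric matrix in characteristic two, the permanent of a
  -- principal submatrix only sees the involutions: a permutation and its
  -- inverse contribute equal terms, which cancel unless they coincide.
  module _ {A : X → X → Carrier} (A-sym : ∀ x y → A x y ≈ A y x) where
    mutual
      perm≈invSum : ∀ {d} (S : Fin d → X) → perm A S S ≈ invSum A S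
      perm≈invSum {zero}  S = refl
      perm≈invSum {suc d} S =
        +-cong (*-congˡ {A (head S) (head S)} (perm≈invSum (tail S))) (offDiagonal S)

      -- the terms of the first-row expansion that move the first position
      offDiagonal : ∀ {d} (S : Fin (suc d) → X) →
                    sum (λ j → A (head S) (tail S j) * perm A (tail S) (removeAt S (suc j)))
                      ≈ pairSum A (head S) (tail S)
      offDiagonal {zero}  S = refl
      offDiagonal {suc d} S = begin
        sum (λ j → A a (T j) * perm A T (removeAt S (suc j)))
          ≈⟨ sum-cong-≋ (λ j → *-congˡ {A a (T j)} (perm-column A T (removeAt S (suc j)))) ⟩
        sum (λ j → A a (T j) * sum (λ i → A (T i) a * P i j))
          ≈⟨ sum-cong-≋ (λ j → *-distribˡ-sum (A a (T j)) (λ i → A (T i) a * P i j)) ⟩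
        sum (λ j → sum (F j))
          ≈⟨ sum-symmetric F F-sym ⟩
        sum (λ j → F j j)
          ≈⟨ sum-cong-≋ diagonal ⟩
        pairSum A a T ∎
        where
        a : X
        a = head S
        T : Fin (suc d) → X
        T = tail S
        P : Fin (suc d) → Fin (suc d) → Carrier
        P i j = perm A (removeAt T i) (removeAt T j)
        F : Fin (suc d) → Fin (suc d) → Carrier
        F j i = A a (T j) * (A (T i) a * P i j)
        F-sym : ∀ j i → F j i ≈ F i j
        F-sym j i = trans (x*[y*z]≈y*[x*z] (A a (T j)) (A (T i) a) (P i j))
          (*-cong (A-sym (T i) a) (*-cong (A-sym a (T j)) (perm-symmetric A-sym (removeAt T i) (removeAt T j))))
        diagonal : ∀ j → F j j ≈ (A a (T j) * A a (T j)) * invSum A (removeAt T j)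
        diagonal j = begin
          A a (T j) * (A (T j) a * P j j)     ≈⟨ *-assoc _ _ _ ⟨
          (A a (T j) * A (T j) a) * P j j     ≈⟨ *-cong (*-congˡ (A-sym (T j) a)) (perm≈invSum (removeAt T j)) ⟩
          (A a (T j) * A a (T j)) * invSum A (removeAt T j) ∎

-- Perfect matchings of H[U], recognised edge by edge: the traces
-- e ∩ U of the chosen edges are removed one after another from the
-- set W of vertices still to be covered.
module Partitions {n : ℕ} (U : Subset n) where

  open SubsetTests
  open ≡ using (refl; sym; trans; cong; cong₂; subst)
  open import Function using (_⇔_; mk⇔)
  open import Function.Construct.Composition using (_⇔-∘_)
  open import Function.Construct.Symmetry using (⇔-sym)
  open import Data.Product.Function.NonDependent.Propositional using (_×-⇔_)
  open import Data.Bool using (T)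
  open import Data.Bool.Properties using (T-≡; T-not-≡; T-∧)

  trace : ∀ {r} → Edges n r → Fin r → Subset n
  trace E e = E e ∩ U

  partitionsᵇ : ∀ {r} → Edges n r → Subset n → Subset r → Bool
  partitionsᵇ {zero}  E W []          = not (nonemptyᵇ W)
  partitionsᵇ {suc r} E W (false ∷ M) = partitionsᵇ (E ∘ suc) W M
  partitionsᵇ {suc r} E W (true  ∷ M) =
    fitsᵇ (trace E zero) W ∧ partitionsᵇ (E ∘ suc) (W ─ trace E zero) M

  degree : ∀ {r} → Edges n r → Subset r → Fin n → ℕ
  degree E M a = ∣ M ∩ incident E a ∣

  Partition : ∀ {r} → Edges n r → Subset n → Subset r → Set
  Partition E W M = (∀ e → lookup M e ≡ true → fitsᵇ (trace E e) W ≡ true) ×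
                    (∀ a → lookup W a ≡ true → degree E M a ≡ 1)

  -- The recursion only visits subsets of U, where traces and edges agree.
  InsideU : Subset n → Set
  InsideU W = ∀ a → lookup W a ≡ true → lookup U a ≡ true

  lookup-trace : ∀ {r} (E : Edges n r) e {a} → lookup U a ≡ true → lookup (trace E e) a ≡ lookup (E e) a
  lookup-trace E e {a} a∈U =
    trans (lookup-zipWith _∧_ a (E e) U) (trans (cong (lookup (E e) a ∧_) a∈U) (∧-identityʳ _))

  degree-cons : ∀ {r} (E : Edges n (suc r)) x M a →
                degree E (x ∷ M) a ≡ (if x ∧ lookup (E zero) a then 1 else 0) ℕ.+ degree (E ∘ suc) M a
  degree-cons E x M a = ∣∷∣ (x ∧ lookup (E zero) a) (M ∩ incident (E ∘ suc) a)

  degree-zero : ∀ {r} (E : Edges n r) M a → (∀ e → lookup M e ≡ true → lookup (E e) a ≡ false) →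
                degree E M a ≡ 0
  degree-zero {zero}  E []          a a∉M = refl
  degree-zero {suc r} E (false ∷ M) a a∉M = degree-zero (E ∘ suc) M a (a∉M ∘ suc)
  degree-zero {suc r} E (true  ∷ M) a a∉M
    rewrite degree-cons E true M a | a∉M zero refl = degree-zero (E ∘ suc) M a (a∉M ∘ suc)

  degree-pos : ∀ {r} (E : Edges n r) M a e → lookup M e ≡ true → lookup (E e) a ≡ true →
               1 ≤ degree E M a
  degree-pos E (x ∷ M) a zero    e∈M a∈e rewrite degree-cons E x M a | e∈M | a∈e = s≤s z≤n
  degree-pos E (x ∷ M) a (suc e) e∈M a∈e rewrite degree-cons E x M a =
    ℕ.≤-trans (degree-pos (E ∘ suc) M a e e∈M a∈e) (ℕ.m≤n+m _ _)

  Partition-none : ∀ {E : Edges n 0} {W} → Partition E W [] ⇔ nonemptyᵇ W ≡ false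
  Partition-none {E} {W} = mk⇔ to from
    where
    to : Partition E W [] → nonemptyᵇ W ≡ false
    to (_ , covered) with nonemptyᵇ W in ne
    ... | false = refl
    ... | true  with () ← covered _ (proj₂ (nonemptyᵇ-witness W ne))
    from : nonemptyᵇ W ≡ false → Partition E W []
    from W-empty = (λ ()) , λ a a∈W →
      case trans (sym (lookup-replicate a false))
                 (subst (λ V → lookup V a ≡ true) (nonemptyᵇ-false W W-empty) a∈W) of λ ()

  Partition-skip : ∀ {r} {E : Edges n (suc r)} {W M} → Partition E W (false ∷ M) ⇔ Partition (E ∘ suc) W M
  Partition-skip = mk⇔ (λ (fits , covered) → fits ∘ suc , covered)
                       (λ (fits , covered) → (λ { (suc e) → fits e }) , covered)

  module TakeFirst {r} (E : Edges n (suc r)) (W : Subset n) (M : Subset r) (W⊆U : InsideU W) where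

    P : Subset n
    P = trace E zero

    E′ : Edges n r
    E′ = E ∘ suc

    first-edge : ∀ a → lookup W a ≡ true → lookup P a ≡ lookup (E zero) a
    first-edge a a∈W = lookup-trace E zero (W⊆U a a∈W)

    only-first : ∀ a → lookup (E zero) a ≡ true → degree E (true ∷ M) a ≡ 1 → degree E′ M a ≡ 0
    only-first a a∈E₀ once rewrite degree-cons E true M a | a∈E₀ = ℕ.suc-injective once

    take⇒ : Partition E W (true ∷ M) → fitsᵇ P W ≡ true × Partition E′ (W ─ P) M
    take⇒ (fits , covered) = fits zero refl , fits′ , covered′
      where
      -- a vertex x shared by P and a later trace would be covered twice
      disjoint : ∀ e → lookup M e ≡ true → disjointᵇ (trace E′ e) P ≡ true
      disjoint e e∈M with disjointᵇ (trace E′ e) P in dj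
      ... | true  = refl
      ... | false with disjointᵇ-witness (trace E′ e) P dj
      ...   | x , x∈Q , x∈P =
        case subst (1 ≤_) (only-first x x∈E₀ (covered x x∈W)) (degree-pos E′ M x e e∈M x∈E) of λ ()
        where
        x∈W : lookup W x ≡ true
        x∈W = ⊆ᵇ-sound (trace E′ e) W (∧-trueʳ (fits (suc e) e∈M)) x∈Q
        x∈E₀ : lookup (E zero) x ≡ true
        x∈E₀ = trans (sym (first-edge x x∈W)) x∈P
        x∈E : lookup (E′ e) x ≡ true
        x∈E = trans (sym (lookup-trace E′ e (W⊆U x x∈W))) x∈Q
      fits′ : ∀ e → lookup M e ≡ true → fitsᵇ (trace E′ e) (W ─ P) ≡ true
      fits′ e e∈M = trans (fitsᵇ-─ (trace E′ e) W P)
                          (cong₂ _∧_ (fits (suc e) e∈M) (disjoint e e∈M))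
      covered′ : ∀ a → lookup (W ─ P) a ≡ true → degree E′ M a ≡ 1
      covered′ a a∈W─P = trans (cong (λ b → (if b then 1 else 0) ℕ.+ degree E′ M a) (sym a∉E₀))
                                (trans (sym (degree-cons E true M a)) (covered a a∈W))
        where
        a∈W : lookup W a ≡ true
        a∈W = proj₁ (∈-─⁻ W P a∈W─P)
        a∉E₀ : lookup (E zero) a ≡ false
        a∉E₀ = trans (sym (first-edge a a∈W)) (proj₂ (∈-─⁻ W P a∈W─P))

    take⇐ : fitsᵇ P W ≡ true × Partition E′ (W ─ P) M → Partition E W (true ∷ M)
    take⇐ (fitsP , fits′ , covered′) = fits , covered
      where
      fits-and-disjoint : ∀ e → lookup M e ≡ true → fitsᵇ (trace E′ e) W ∧ disjointᵇ (trace E′ e) P ≡ true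
      fits-and-disjoint e e∈M = trans (sym (fitsᵇ-─ (trace E′ e) W P)) (fits′ e e∈M)
      fits : ∀ e → lookup (true ∷ M) e ≡ true → fitsᵇ (trace E e) W ≡ true
      fits zero    _   = fitsP
      fits (suc e) e∈M = ∧-trueˡ (fits-and-disjoint e e∈M)
      covered : ∀ a → lookup W a ≡ true → degree E (true ∷ M) a ≡ 1
      covered a a∈W rewrite degree-cons E true M a | sym (first-edge a a∈W) with lookup P a in a∈P
      ... | true  = cong suc (degree-zero E′ M a not-later)
        where
        -- the later traces are disjoint from P ∋ a
        not-later : ∀ e → lookup M e ≡ true → lookup (E′ e) a ≡ false
        not-later e e∈M with lookup (E′ e) a in a∈E
        ... | false = refl
        ... | true  = case trans (sym (∧-trueʳ (fits-and-disjoint e e∈M)))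
                                 (disjointᵇ-shared (trace E′ e) P
                                   (trans (lookup-trace E′ e (W⊆U a a∈W)) a∈E) a∈P) of λ ()
      ... | false = covered′ a (∈-─⁺ W P a∈W a∈P)

  Partition-take : ∀ {r} {E : Edges n (suc r)} {W M} → InsideU W →
                   Partition E W (true ∷ M) ⇔
                   (fitsᵇ (trace E zero) W ≡ true × Partition (E ∘ suc) (W ─ trace E zero) M)
  Partition-take {E = E} {W} {M} W⊆U = mk⇔ take⇒ take⇐
    where open TakeFirst E W M W⊆U

  partitionsᵇ-correct : ∀ {r} (E : Edges n r) W M → InsideU W → T (partitionsᵇ E W M) ⇔ Partition E W M
  partitionsᵇ-correct {zero}  E W []          W⊆U = ⇔-sym (Partition-none {E} {W}) ⇔-∘ T-not-≡
  partitionsᵇ-correct {suc r} E W (false ∷ M) W⊆U =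
    ⇔-sym (Partition-skip {E = E} {W} {M}) ⇔-∘ partitionsᵇ-correct (E ∘ suc) W M W⊆U
  partitionsᵇ-correct {suc r} E W (true  ∷ M) W⊆U =
    ⇔-sym (Partition-take {E = E} {W} {M} W⊆U)
      ⇔-∘ ((T-≡ ×-⇔ partitionsᵇ-correct (E ∘ suc) W′ M W′⊆U) ⇔-∘ T-∧)
    where
    W′ : Subset n
    W′ = W ─ trace E zero
    W′⊆U : InsideU W′
    W′⊆U a a∈W′ = W⊆U a (proj₁ (∈-─⁻ W (trace E zero) a∈W′))

  Partition⇔IsPerfectMatching : ∀ {r} (E : Edges n r) M → Partition E U M ⇔ IsPerfectMatching E U M
  Partition⇔IsPerfectMatching E M = mk⇔ to from
    where
    to : Partition E U M → IsPerfectMatching E U M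
    to (fits , covered) =
      (λ e e∈M trace≡⊥ → case trans (sym (∧-trueˡ (fits e ([]=⇒lookup e∈M))))
                                     (trans (cong nonemptyᵇ trace≡⊥) (nonemptyᵇ-⊥ n)) of λ ()) ,
      (λ a a∈U → covered a ([]=⇒lookup a∈U))
    from : IsPerfectMatching E U M → Partition E U M
    from (nonempty , covered) = fits , (λ a a∈U → covered a (lookup⇒[]= a U a∈U))
      where
      fits : ∀ e → lookup M e ≡ true → fitsᵇ (trace E e) U ≡ true
      fits e e∈M with nonemptyᵇ (trace E e) in ne
      ... | false = ⊥-elim (nonempty e (lookup⇒[]= e M e∈M) (nonemptyᵇ-false (trace E e) ne))
      ... | true  = ⊆ᵇ-complete (trace E e) U
                      (λ x x∈trace → ∧-trueʳ (trans (sym (lookup-zipWith _∧_ x (E e) U)) x∈trace))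

  partitionsᵇ≡isPerfectMatching : ∀ {r} (E : Edges n r) M →
                                   partitionsᵇ E U M ≡ does (isPerfectMatching? E U M)
  partitionsᵇ≡isPerfectMatching E M =
    does-⇔ (Partition⇔IsPerfectMatching E M ⇔-∘ partitionsᵇ-correct E U M (λ _ a∈U → a∈U))
           (T? _) (isPerfectMatching? E U M)

-- Weighted sums over the partitions of a vertex set W ⊆ U by traces of
-- edges; for W = U this is the matching sum of the theorem.
module PartitionSums {c ℓ} (R : CommutativeRing c ℓ) (char2 : CharTwo R) {n : ℕ} (U : Subset n)
                     (s : CommutativeRing.Carrier R) where

  open CommutativeRing R hiding (zero)
  open Over R
  open CharTwoSums R char2
  open SubsetTests
  open Partitions U
  open import Data.Fin.Subset.Properties using (_∈?_; p─q─r≡p─r─q)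
  open import Relation.Binary.Reasoning.Setoid setoid

  guard : Bool → Carrier → Carrier
  guard b x = if b then x else 0#

  weight : ∀ {r} → Edges n r → (Fin r → Carrier) → Subset r → Carrier
  weight {r} E v M = (s ^ Λ E U M) * Π[ r ] (λ e → if does (e ∈? M) then v e ^ p E U e else 1#)

  -- the factor s^[e is a loop] · v_e^p(e) that a chosen edge contributes,
  -- as a function of the size k of its trace and of x = v_e
  edgeFactor : ℕ → Carrier → Carrier
  edgeFactor k x = (s ^ (if does (k ℕ.≟ 1) then 1 else 0)) * (x ^ (if does (k ℕ.≟ 1) then 1 else 2))

  edgeWeight : ∀ {r} → Edges n r → (Fin r → Carrier) → Fin r → Carrier
  edgeWeight E v e = edgeFactor ∣ trace E e ∣ (v e)

  partitionSum : ∀ {r} → Edges n r → (Fin r → Carrier) → Subset n → Carrier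
  partitionSum {r} E v W = ΣSubsets r (λ M → guard (partitionsᵇ E W M) (weight E v M))

  guard-cong : ∀ b {x y} → x ≈ y → guard b x ≈ guard b y
  guard-cong true  x≈y = x≈y
  guard-cong false x≈y = refl

  guard-0 : ∀ b → guard b 0# ≈ 0#
  guard-0 true  = refl
  guard-0 false = refl

  *-guard : ∀ b x y → x * guard b y ≈ guard b (x * y)
  *-guard true  x y = refl
  *-guard false x y = zeroʳ x

  guard-+ : ∀ b x y → guard b (x + y) ≈ guard b x + guard b y
  guard-+ true  x y = refl
  guard-+ false x y = sym (+-identityˡ 0#)

  guard-* : ∀ b x y → guard b x * y ≈ guard b (x * y)
  guard-* true  x y = refl
  guard-* false x y = zeroˡ y

  guard-square : ∀ b x → guard b x * guard b x ≈ guard b (x * x)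
  guard-square true  x = refl
  guard-square false x = zeroˡ 0#

  guard-false : ∀ {b} x → b ≡ false → guard b x ≈ 0#
  guard-false x ≡.refl = refl

  *-guard-∧ : ∀ b b′ x y z → x * guard (b ∧ b′) (y * z) ≈ guard b (y * guard b′ (x * z))
  *-guard-∧ false b′    x y z = zeroʳ x
  *-guard-∧ true  false x y z = trans (zeroʳ x) (sym (zeroʳ y))
  *-guard-∧ true  true  x y z = x*[y*z]≈y*[x*z] x y z

  ^-+ : ∀ x a b → x ^ (a ℕ.+ b) ≈ (x ^ a) * (x ^ b)
  ^-+ x zero    b = sym (*-identityˡ _)
  ^-+ x (suc a) b = trans (*-congˡ (^-+ x a b)) (sym (*-assoc _ _ _))

  weight-skip : ∀ {r} (E : Edges n (suc r)) v M → weight E v (false ∷ M) ≈ weight (E ∘ suc) (v ∘ suc) M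
  weight-skip E v M = *-congˡ (*-identityˡ _)

  weight-take : ∀ {r} (E : Edges n (suc r)) v M →
                weight E v (true ∷ M) ≈ edgeWeight E v zero * weight (E ∘ suc) (v ∘ suc) M
  weight-take {r} E v M = begin
    (s ^ Λ E U (true ∷ M)) * (v zero ^ p E U zero * Π′)
      ≡⟨ ≡.cong (λ k → (s ^ k) * (v zero ^ p E U zero * Π′))
                (∣∷∣ (does (isLoop? E U zero)) (M ∩ loops (E ∘ suc) U)) ⟩
    (s ^ (loop ℕ.+ Λ′)) * (v zero ^ p E U zero * Π′)
      ≈⟨ *-congʳ (^-+ s loop Λ′) ⟩
    ((s ^ loop) * (s ^ Λ′)) * (v zero ^ p E U zero * Π′)
      ≈⟨ *-assoc _ _ _ ⟩
    (s ^ loop) * ((s ^ Λ′) * (v zero ^ p E U zero * Π′))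
      ≈⟨ *-congˡ (x*[y*z]≈y*[x*z] _ _ _) ⟩
    (s ^ loop) * (v zero ^ p E U zero * ((s ^ Λ′) * Π′))
      ≈⟨ *-assoc _ _ _ ⟨
    edgeWeight E v zero * weight (E ∘ suc) (v ∘ suc) M ∎
    where
    loop Λ′ : ℕ
    loop = if does (isLoop? E U zero) then 1 else 0
    Λ′ = Λ (E ∘ suc) U M
    Π′ : Carrier
    Π′ = Π[ r ] (λ e → if does (e ∈? M) then v (suc e) ^ p E U (suc e) else 1#)

  partitionSum-step : ∀ {r} (E : Edges n (suc r)) v W →
    partitionSum E v W ≈ partitionSum (E ∘ suc) (v ∘ suc) W
                         + guard (fitsᵇ (trace E zero) W)
                                 (edgeWeight E v zero * partitionSum (E ∘ suc) (v ∘ suc) (W ─ trace E zero))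
  partitionSum-step {r} E v W =
    +-cong (ΣSubsets-cong r (λ M → guard-cong (partitionsᵇ E′ W M) (weight-skip E v M)))
           (taken (fitsᵇ (trace E zero) W))
    where
    E′ : Edges n r
    E′ = E ∘ suc
    W′ : Subset n
    W′ = W ─ trace E zero
    taken : ∀ b → ΣSubsets r (λ M → guard (b ∧ partitionsᵇ E′ W′ M) (weight E v (true ∷ M)))
                  ≈ guard b (edgeWeight E v zero * partitionSum E′ (v ∘ suc) W′)
    taken false = ΣSubsets-0 r
    taken true  = begin
      ΣSubsets r (λ M → guard (partitionsᵇ E′ W′ M) (weight E v (true ∷ M)))
        ≈⟨ ΣSubsets-cong r (λ M → guard-cong (partitionsᵇ E′ W′ M) (weight-take E v M)) ⟩
      ΣSubsets r (λ M → guard (partitionsᵇ E′ W′ M) (edgeWeight E v zero * weight E′ (v ∘ suc) M))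
        ≈⟨ ΣSubsets-cong r (λ M → sym (*-guard (partitionsᵇ E′ W′ M) _ _)) ⟩
      ΣSubsets r (λ M → edgeWeight E v zero * guard (partitionsᵇ E′ W′ M) (weight E′ (v ∘ suc) M))
        ≈⟨ ΣSubsets-* r _ _ ⟩
      edgeWeight E v zero * partitionSum E′ (v ∘ suc) W′ ∎

  partitionSum-⊥ : ∀ {r} (E : Edges n r) v → partitionSum E v ⊥ ≈ 1#
  partitionSum-⊥ {zero}  E v rewrite nonemptyᵇ-⊥ n = *-identityˡ 1#
  partitionSum-⊥ {suc r} E v = begin
    partitionSum E v ⊥
      ≈⟨ partitionSum-step E v ⊥ ⟩
    partitionSum (E ∘ suc) (v ∘ suc) ⊥ + guard (fitsᵇ (trace E zero) ⊥) rest
      ≡⟨ ≡.cong (λ b → partitionSum (E ∘ suc) (v ∘ suc) ⊥ + guard b rest) (fitsᵇ-⊥ (trace E zero)) ⟩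
    partitionSum (E ∘ suc) (v ∘ suc) ⊥ + 0#
      ≈⟨ +-identityʳ _ ⟩
    partitionSum (E ∘ suc) (v ∘ suc) ⊥
      ≈⟨ partitionSum-⊥ (E ∘ suc) (v ∘ suc) ⟩
    1# ∎
    where rest = edgeWeight E v zero * partitionSum (E ∘ suc) (v ∘ suc) (⊥ ─ trace E zero)

  -- Expansion along a vertex a ∈ W: the block through a is the trace of
  -- some edge e, and the rest is a partition of what remains of W.
  vertexExpansion : ∀ {r} → Edges n r → (Fin r → Carrier) → Fin n → Subset n → Carrier
  vertexExpansion E v a W =
    sum (λ e → guard (blockAtᵇ a (trace E e) W) (edgeWeight E v e * partitionSum E v (W ─ trace E e)))

  module FirstEdge {r} (E : Edges n (suc r)) (v : Fin (suc r) → Carrier) (W : Subset n) (a : Fin n) where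
    E′ : Edges n r
    E′ = E ∘ suc
    v′ : Fin r → Carrier
    v′ = v ∘ suc
    P : Subset n
    P = trace E zero
    c₀ : Carrier
    c₀ = edgeWeight E v zero
    Φ′ : Subset n → Carrier
    Φ′ = partitionSum E′ v′

    -- The term of a later edge e in the vertex expansion at a splits by
    -- whether the first edge is chosen too: A e without it, B e with it.
    A B : Fin r → Carrier
    A e = guard (blockAtᵇ a (trace E′ e) W) (edgeWeight E′ v′ e * Φ′ (W ─ trace E′ e))
    B e = guard (blockAtᵇ a (trace E′ e) W)
                (edgeWeight E′ v′ e * guard (fitsᵇ P (W ─ trace E′ e)) (c₀ * Φ′ (W ─ trace E′ e ─ P)))

    later-edge : ∀ e → guard (blockAtᵇ a (trace E′ e) W) (edgeWeight E′ v′ e * partitionSum E v (W ─ trace E′ e))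
                       ≈ A e + B e
    later-edge e = begin
      guard g (cₑ * partitionSum E v (W ─ Q))
        ≈⟨ guard-cong g (*-congˡ (partitionSum-step E v (W ─ Q))) ⟩
      guard g (cₑ * (Φ′ (W ─ Q) + guard (fitsᵇ P (W ─ Q)) (c₀ * Φ′ (W ─ Q ─ P))))
        ≈⟨ guard-cong g (distribˡ _ _ _) ⟩
      guard g (cₑ * Φ′ (W ─ Q) + cₑ * guard (fitsᵇ P (W ─ Q)) (c₀ * Φ′ (W ─ Q ─ P)))
        ≈⟨ guard-+ g _ _ ⟩
      A e + B e ∎
      where
      Q : Subset n
      Q = trace E′ e
      g : Bool
      g = blockAtᵇ a Q W
      cₑ : Carrier
      cₑ = edgeWeight E′ v′ e

    -- Once the first edge is used up it cannot be chosen again.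
    first-edge-used : partitionSum E v (W ─ P) ≈ Φ′ (W ─ P)
    first-edge-used = begin
      partitionSum E v (W ─ P)                        ≈⟨ partitionSum-step E v (W ─ P) ⟩
      Φ′ (W ─ P) + guard (fitsᵇ P (W ─ P)) (c₀ * Φ′ (W ─ P ─ P))
        ≡⟨ ≡.cong (λ b → Φ′ (W ─ P) + guard b (c₀ * Φ′ (W ─ P ─ P))) (fitsᵇ-─-self P W) ⟩
      Φ′ (W ─ P) + 0#                                 ≈⟨ +-identityʳ _ ⟩
      Φ′ (W ─ P)                                      ∎

    B-misfit : ∀ e → fitsᵇ P (W ─ trace E′ e) ≡ false → B e ≈ 0#
    B-misfit e misfit =
      trans (guard-cong (blockAtᵇ a (trace E′ e) W) (trans (*-congˡ (guard-false _ misfit)) (zeroʳ _))) (guard-0 _)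

    -- If P fits in W, choosing P and then a block Q through a in W ─ P is
    -- choosing Q and then P, for the blocks Q disjoint from P.
    choose-later : fitsᵇ P W ≡ true → ∀ e →
                   c₀ * guard (blockAtᵇ a (trace E′ e) (W ─ P))
                              (edgeWeight E′ v′ e * Φ′ (W ─ P ─ trace E′ e)) ≈ B e
    choose-later P-fits e = begin
      c₀ * guard (blockAtᵇ a Q (W ─ P)) (edgeWeight E′ v′ e * Φ′ (W ─ P ─ Q))
        ≡⟨ ≡.cong₂ (λ b V → c₀ * guard b (edgeWeight E′ v′ e * Φ′ V)) blockAt≡ (p─q─r≡p─r─q W P Q) ⟩
      c₀ * guard (blockAtᵇ a Q W ∧ disjointᵇ Q P) (edgeWeight E′ v′ e * Φ′ (W ─ Q ─ P))
        ≈⟨ *-guard-∧ (blockAtᵇ a Q W) (disjointᵇ Q P) c₀ (edgeWeight E′ v′ e) _ ⟩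
      guard (blockAtᵇ a Q W) (edgeWeight E′ v′ e * guard (disjointᵇ Q P) (c₀ * Φ′ (W ─ Q ─ P)))
        ≡⟨ ≡.cong (λ b → guard (blockAtᵇ a Q W) (edgeWeight E′ v′ e * guard b (c₀ * Φ′ (W ─ Q ─ P))))
                  fits≡ ⟨
      B e ∎
      where
      Q : Subset n
      Q = trace E′ e
      blockAt≡ : blockAtᵇ a Q (W ─ P) ≡ blockAtᵇ a Q W ∧ disjointᵇ Q P
      blockAt≡ = ≡.trans (≡.cong (lookup Q a ∧_) (⊆ᵇ-─ Q W P)) (≡.sym (∧-assoc (lookup Q a) _ _))
      fits≡ : fitsᵇ P (W ─ Q) ≡ disjointᵇ Q P
      fits≡ = ≡.trans (fitsᵇ-─ P W Q) (≡.trans (≡.cong (_∧ disjointᵇ P Q) P-fits) (disjointᵇ-comm P Q))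

    -- If the first edge avoids a, its partitions are those of the
    -- other edges' vertex expansion that choose it; if it contains a,
    -- it can only be the block through a.
    FirstEdgeSplit : Set ℓ
    FirstEdgeSplit = guard (fitsᵇ P W) (c₀ * Φ′ (W ─ P)) ≈ guard (blockAtᵇ a P W) (c₀ * Φ′ (W ─ P)) + sum B

    through-a : lookup P a ≡ true → FirstEdgeSplit
    through-a a∈P = begin
      guard (fitsᵇ P W) X                 ≡⟨ ≡.cong (λ b → guard b X) fits≡blockAt ⟩
      guard (blockAtᵇ a P W) X            ≈⟨ +-identityʳ _ ⟨
      guard (blockAtᵇ a P W) X + 0#       ≈⟨ +-congˡ (sum-zero B≈0) ⟨
      guard (blockAtᵇ a P W) X + sum B    ∎
      where
      X : Carrier
      X = c₀ * Φ′ (W ─ P)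
      fits≡blockAt : fitsᵇ P W ≡ blockAtᵇ a P W
      fits≡blockAt = ≡.cong (_∧ (P ⊆ᵇ W)) (≡.trans (nonemptyᵇ-∈ P a∈P) (≡.sym a∈P))
      -- no other block through a can be chosen together with P ∋ a
      B≈0 : ∀ e → B e ≈ 0#
      B≈0 e = by-membership (lookup (trace E′ e) a) ≡.refl
        where
        by-membership : ∀ t → lookup (trace E′ e) a ≡ t → B e ≈ 0#
        by-membership false a∉Q = guard-false _ (≡.cong (_∧ (trace E′ e ⊆ᵇ W)) a∉Q)
        by-membership true  a∈Q = B-misfit e (≡.trans (fitsᵇ-─ P W (trace E′ e))
          (≡.trans (≡.cong (fitsᵇ P W ∧_) (disjointᵇ-shared P (trace E′ e) a∈P a∈Q)) (∧-zeroʳ _)))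

    avoiding-a : lookup P a ≡ false → lookup W a ≡ true →
                 (∀ W′ → lookup W′ a ≡ true → Φ′ W′ ≈ vertexExpansion E′ v′ a W′) → FirstEdgeSplit
    avoiding-a a∉P a∈W expand′ =
      trans chosen (trans (sym (+-identityˡ _)) (+-congʳ (sym (guard-false _ (≡.cong (_∧ (P ⊆ᵇ W)) a∉P)))))
      where
      chosen : guard (fitsᵇ P W) (c₀ * Φ′ (W ─ P)) ≈ sum B
      chosen with fitsᵇ P W in P-fits
      ... | false = sym (sum-zero (λ e → B-misfit e
                      (≡.trans (fitsᵇ-─ P W (trace E′ e)) (≡.cong (_∧ disjointᵇ P (trace E′ e)) P-fits))))
      ... | true  = begin
        c₀ * Φ′ (W ─ P)                        ≈⟨ *-congˡ (expand′ (W ─ P) (∈-─⁺ W P a∈W a∉P)) ⟩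
        c₀ * vertexExpansion E′ v′ a (W ─ P)   ≈⟨ *-distribˡ-sum c₀ term ⟩
        sum (λ e → c₀ * term e)                ≈⟨ sum-cong-≋ (choose-later P-fits) ⟩
        sum B                                  ∎
        where
        term : Fin r → Carrier
        term e = guard (blockAtᵇ a (trace E′ e) (W ─ P)) (edgeWeight E′ v′ e * Φ′ (W ─ P ─ trace E′ e))

    first-edge-split : lookup W a ≡ true →
                       (∀ W′ → lookup W′ a ≡ true → Φ′ W′ ≈ vertexExpansion E′ v′ a W′) → FirstEdgeSplit
    first-edge-split a∈W expand′ = split (lookup P a) ≡.refl
      where
      split : ∀ b → lookup P a ≡ b → FirstEdgeSplit
      split true  a∈P = through-a a∈P
      split false a∉P = avoiding-a a∉P a∈W expand′

  partitionSum-vertex : ∀ {r} (E : Edges n r) v W a → lookup W a ≡ true →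
                        partitionSum E v W ≈ vertexExpansion E v a W
  partitionSum-vertex {zero}  E v W a a∈W rewrite nonemptyᵇ-∈ W a∈W = refl
  partitionSum-vertex {suc r} E v W a a∈W = begin
    partitionSum E v W
      ≈⟨ partitionSum-step E v W ⟩
    Φ′ W + guard (fitsᵇ P W) (c₀ * Φ′ (W ─ P))
      ≈⟨ +-cong (partitionSum-vertex E′ v′ W a a∈W)
                (first-edge-split a∈W (λ W′ → partitionSum-vertex E′ v′ W′ a)) ⟩
    sum A + (T₀ + sum B)
      ≈⟨ x+[y+z]≈y+[x+z] (sum A) T₀ (sum B) ⟩
    T₀ + (sum A + sum B)
      ≈⟨ +-congˡ (∑-distrib-+ A B) ⟨
    T₀ + sum (λ e → A e + B e)
      ≈⟨ +-cong (guard-cong (blockAtᵇ a P W) (*-congˡ first-edge-used)) (sum-cong-≋ later-edge) ⟨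
    vertexExpansion E v a W ∎
    where
    open FirstEdge E v W a
    T₀ : Carrier
    T₀ = guard (blockAtᵇ a P W) (c₀ * Φ′ (W ─ P))
module TutteMatrix {c ℓ} (R : CommutativeRing c ℓ) (char2 : CharTwo R) {n r} (E : Edges n r) (U : Subset n)
                   (s : CommutativeRing.Carrier R) (v : Fin r → CommutativeRing.Carrier R) where

  open CommutativeRing R hiding (zero; _-_)
  open Over R
  open CharTwoSums R char2
  open SubsetTests
  open Enumerations
  open Partitions U using (trace)
  open PartitionSums R char2 U s
  open Permanents R char2 {Fin n} using (invSum; pairSum)
  open import Data.Fin.Subset.Properties using (∪-comm; p─q─r≡p─q∪r)
  open import Data.Vec.Functional using (removeAt)
  open import Function using (mk⇔)
  open import Relation.Nullary using (Dec)
  import Data.Fin.Properties as FinP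
  open import Relation.Binary.Reasoning.Setoid setoid

  entry : Fin n → Fin n → Bool → Carrier
  entry a b diagonal = if diagonal then s * Σedges E U v ⁅ a ⁆ else Σedges E U v (⁅ a ⁆ ∪ ⁅ b ⁆)

  T : Fin n → Fin n → Carrier
  T a b = entry a b (does (a ≟ b))

  T-sym : ∀ a b → T a b ≈ T b a
  T-sym a b with a ≟ b | b ≟ a
  ... | yes ≡.refl | yes _   = refl
  ... | yes ≡.refl | no a≢a  = ⊥-elim (a≢a ≡.refl)
  ... | no a≢b     | yes b≡a = ⊥-elim (a≢b (≡.sym b≡a))
  ... | no _       | no _    = reflexive (≡.cong (Σedges E U v) (∪-comm ⁅ a ⁆ ⁅ b ⁆))

  tutte≡T : ∀ i j → tutte E U s v i j ≡ T (enum U i) (enum U j)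
  tutte≡T i j = ≡.cong (entry (enum U i) (enum U j))
                       (does-⇔ (mk⇔ (≡.cong (enum U)) (enum-injective U)) (i ≟ j) (enum U i ≟ enum U j))
    where
    enum-injective : ∀ {m} (V : Subset m) {i j} → enum V i ≡ enum V j → i ≡ j
    enum-injective (true  ∷ V) {zero}  {zero}  _ = ≡.refl
    enum-injective (true  ∷ V) {suc i} {suc j} e = ≡.cong suc (enum-injective V (FinP.suc-injective e))
    enum-injective (false ∷ V)                 e = enum-injective V (FinP.suc-injective e)

  Φ : Subset n → Carrier
  Φ = partitionSum E v

  Σedges≈ : ∀ S → Σedges E U v S ≡ sum (λ e → guard (does (trace E e ≟S S)) (v e))
  Σedges≈ S = Σ≡sum r _

  diagonal-term : ∀ a X → T a a * X ≈ sum (λ e → guard (does (trace E e ≟S ⁅ a ⁆)) ((s * v e) * X))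
  diagonal-term a X = begin
    T a a * X
      ≡⟨ ≡.cong (λ b → entry a a b * X) (dec-true (a ≟ a) ≡.refl) ⟩
    (s * Σedges E U v ⁅ a ⁆) * X
      ≡⟨ ≡.cong (λ y → (s * y) * X) (Σedges≈ ⁅ a ⁆) ⟩
    (s * sum (λ e → guard (loop e) (v e))) * X
      ≈⟨ *-congʳ (*-distribˡ-sum s (λ e → guard (loop e) (v e))) ⟩
    sum (λ e → s * guard (loop e) (v e)) * X
      ≈⟨ *-distribʳ-sum X (λ e → s * guard (loop e) (v e)) ⟩
    sum (λ e → (s * guard (loop e) (v e)) * X)
      ≈⟨ sum-cong-≋ (λ e → trans (*-congʳ (*-guard (loop e) s (v e))) (guard-* (loop e) (s * v e) X)) ⟩
    sum (λ e → guard (loop e) ((s * v e) * X)) ∎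
    where
    loop : Fin r → Bool
    loop e = does (trace E e ≟S ⁅ a ⁆)

  -- An off-diagonal entry collects the edges with trace {a, b}; its
  -- square is the sum of the squares (characteristic two).
  pair-term : ∀ a b → a ≢ b → ∀ X →
              (T a b * T a b) * X ≈ sum (λ e → guard (does (trace E e ≟S (⁅ a ⁆ ∪ ⁅ b ⁆))) ((v e * v e) * X))
  pair-term a b a≢b X = begin
    (T a b * T a b) * X
      ≡⟨ ≡.cong (λ y → (y * y) * X) (≡.trans T-ab (Σedges≈ (⁅ a ⁆ ∪ ⁅ b ⁆))) ⟩
    (sum f * sum f) * X                        ≈⟨ *-congʳ (square-sum f) ⟩
    sum (λ e → f e * f e) * X                  ≈⟨ *-distribʳ-sum X (λ e → f e * f e) ⟩
    sum (λ e → (f e * f e) * X)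
      ≈⟨ sum-cong-≋ (λ e → trans (*-congʳ (guard-square (pair e) (v e))) (guard-* (pair e) (v e * v e) X)) ⟩
    sum (λ e → guard (pair e) ((v e * v e) * X)) ∎
    where
    pair : Fin r → Bool
    pair e = does (trace E e ≟S (⁅ a ⁆ ∪ ⁅ b ⁆))
    f : Fin r → Carrier
    f e = guard (pair e) (v e)
    T-ab : T a b ≡ Σedges E U v (⁅ a ⁆ ∪ ⁅ b ⁆)
    T-ab = ≡.cong (entry a b) (dec-false (a ≟ b) a≢b)

  sum-indicator : ∀ {d} (S : Fin d → Fin n) W → Enumerates S W → ∀ b (f : Fin n → Carrier) →
                  sum (λ j → guard (does (b ≟ S j)) (f (S j))) ≈ guard (lookup W b) (f b)
  sum-indicator {zero}  S W W≡⊥ b f =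
    sym (guard-false (f b) (≡.trans (≡.cong (λ V → lookup V b) W≡⊥) (lookup-replicate b false)))
  sum-indicator {suc d} S W (S₀∈W , rest) b f =
    trans (+-congˡ (sum-indicator (S ∘ suc) (W - S zero) rest b f)) (first (b ≟ S zero))
    where
    first : (b≟S₀ : Dec (b ≡ S zero)) →
            guard (does b≟S₀) (f (S zero)) + guard (lookup (W - S zero) b) (f b) ≈ guard (lookup W b) (f b)
    first (yes ≡.refl) rewrite lookup-remove W b b | dec-true (b ≟ b) ≡.refl | S₀∈W =
      +-identityʳ (f b)
    first (no b≢S₀) rewrite lookup-remove W (S zero) b | dec-false (S zero ≟ b) (b≢S₀ ∘ ≡.sym)
                          | ∧-identityʳ (lookup W b) = +-identityˡ _

  edgeFactor-1 : ∀ x → edgeFactor 1 x ≈ s * x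
  edgeFactor-1 x = *-cong (*-identityʳ s) (*-identityʳ x)

  edgeFactor-2 : ∀ x → edgeFactor 2 x ≈ x * x
  edgeFactor-2 x = trans (*-identityˡ _) (*-congˡ (*-identityʳ x))

  module AtVertex {d} (W : Subset n) (a : Fin n) (S′ : Fin d → Fin n)
                  (a∈W : lookup W a ≡ true) (S′-enum : Enumerates S′ (W - a)) where

    -- What an edge with trace Q and variable x contributes: as a loop at
    -- a, or as an edge joining a with one of the vertices S′ j.
    pairTerms : Subset n → Carrier → Carrier
    pairTerms Q x = sum (λ j → guard (does (Q ≟S (⁅ a ⁆ ∪ ⁅ S′ j ⁆))) ((x * x) * Φ (W - a - S′ j)))

    edgeTerm : Subset n → Carrier → Carrier
    edgeTerm Q x = guard (does (Q ≟S ⁅ a ⁆)) ((s * x) * Φ (W - a)) + pairTerms Q x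

    vertexTerm : Subset n → Carrier → Carrier
    vertexTerm Q x = guard (blockAtᵇ a Q W) (edgeFactor ∣ Q ∣ x * Φ (W ─ Q))

    S′∈W-a : ∀ j → lookup (W - a) (S′ j) ≡ true
    S′∈W-a = Enumerates-∈ S′ (W - a) S′-enum

    a≢S′ : ∀ j → a ≢ S′ j
    a≢S′ j = ∉⁅⁆⇒≢ a (S′ j) (proj₂ (∈-─⁻ W ⁅ a ⁆ (S′∈W-a j)))

    singleton-case : ∀ x → edgeTerm ⁅ a ⁆ x ≈ vertexTerm ⁅ a ⁆ x
    singleton-case x = begin
      edgeTerm ⁅ a ⁆ x
        ≈⟨ +-cong (reflexive (≡.cong (λ t → guard t ((s * x) * Φ (W - a)))
                                     (dec-true (⁅ a ⁆ ≟S ⁅ a ⁆) ≡.refl)))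
                  (sum-zero (λ j → guard-false _ (singleton≢pair (a≢S′ j)))) ⟩
      (s * x) * Φ (W - a) + 0#
        ≈⟨ +-identityʳ _ ⟩
      (s * x) * Φ (W - a)
        ≈⟨ *-congʳ (edgeFactor-1 x) ⟨
      edgeFactor 1 x * Φ (W - a)
        ≡⟨ ≡.cong₂ (λ k t → guard t (edgeFactor k x * Φ (W - a))) (≡.sym (∣⁅x⁆∣≡1 a)) (≡.sym blockAt-a) ⟩
      vertexTerm ⁅ a ⁆ x ∎
      where
      blockAt-a : blockAtᵇ a ⁅ a ⁆ W ≡ true
      blockAt-a = ≡.cong₂ _∧_ (a∈⁅a⁆ a) (⁅⁆⊆ W a∈W)

    pair-case : ∀ b x → a ≢ b → lookup W b ≡ true →
                0# + pairTerms (⁅ a ⁆ ∪ ⁅ b ⁆) x ≈ edgeFactor ∣ ⁅ a ⁆ ∪ ⁅ b ⁆ ∣ x * Φ (W ─ (⁅ a ⁆ ∪ ⁅ b ⁆))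
    pair-case b x a≢b b∈W = begin
      0# + pairTerms (⁅ a ⁆ ∪ ⁅ b ⁆) x
        ≈⟨ +-identityˡ _ ⟩
      sum (λ j → guard (does ((⁅ a ⁆ ∪ ⁅ b ⁆) ≟S (⁅ a ⁆ ∪ ⁅ S′ j ⁆))) (g (S′ j)))
        ≡⟨ sum-cong-≗ (λ j → ≡.cong (λ t → guard t (g (S′ j))) (pair≟pair a≢b)) ⟩
      sum (λ j → guard (does (b ≟ S′ j)) (g (S′ j)))
        ≈⟨ sum-indicator S′ (W - a) S′-enum b g ⟩
      guard (lookup (W - a) b) (g b)
        ≡⟨ ≡.cong (λ t → guard t (g b)) b∈W-a ⟩
      (x * x) * Φ (W - a - b)
        ≈⟨ *-congʳ (edgeFactor-2 x) ⟨
      edgeFactor 2 x * Φ (W - a - b)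
        ≡⟨ ≡.cong₂ (λ k V → edgeFactor k x * Φ V) (≡.sym (∣pair∣ a≢b)) (p─q─r≡p─q∪r W ⁅ a ⁆ ⁅ b ⁆) ⟩
      edgeFactor ∣ ⁅ a ⁆ ∪ ⁅ b ⁆ ∣ x * Φ (W ─ (⁅ a ⁆ ∪ ⁅ b ⁆)) ∎
      where
      g : Fin n → Carrier
      g b′ = (x * x) * Φ (W - a - b′)
      b∈W-a : lookup (W - a) b ≡ true
      b∈W-a = ∈-─⁺ W ⁅ a ⁆ b∈W (≢⇒∉⁅⁆ a≢b)

    -- A trace other than {a} is either the block {a, b} through a, for
    -- a unique b, or contributes nothing.
    not-singleton : ∀ Q x → ∣ Q ∣ ≤ 2 → Q ≢ ⁅ a ⁆ → edgeTerm Q x ≈ vertexTerm Q x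
    not-singleton Q x ∣Q∣≤2 Q≢a =
      trans (+-congʳ (guard-false _ (dec-false (Q ≟S ⁅ a ⁆) Q≢a))) (by-block (blockAtᵇ a Q W) ≡.refl)
      where
      by-block : ∀ t → blockAtᵇ a Q W ≡ t → 0# + pairTerms Q x ≈ guard t (edgeFactor ∣ Q ∣ x * Φ (W ─ Q))
      by-block false not-block =
        trans (+-identityˡ _) (sum-zero (λ j → guard-false _ (dec-false (Q ≟S _) (no-pair j))))
        where
        no-pair : ∀ j → Q ≢ ⁅ a ⁆ ∪ ⁅ S′ j ⁆
        no-pair j ≡.refl = case ≡.trans (≡.sym not-block)
          (≡.cong₂ _∧_ (a∈pair a (S′ j)) (pair⊆ W a∈W (proj₁ (∈-─⁻ W ⁅ a ⁆ (S′∈W-a j))))) of λ ()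
      by-block true block with nonemptyᵇ (Q - a) in other
      ... | false = ⊥-elim (Q≢a (only-element Q a (∧-trueˡ block) (nonemptyᵇ-false (Q - a) other)))
      ... | true  = ≡.subst (λ Q′ → 0# + pairTerms Q′ x ≈ edgeFactor ∣ Q′ ∣ x * Φ (W ─ Q′))
                            (pair-unique Q a≢b (∧-trueˡ block) b∈Q ∣Q∣≤2) (pair-case b x a≢b b∈W)
        where
        b : Fin n
        b = proj₁ (nonemptyᵇ-witness (Q - a) other)
        b∈Q-a : lookup (Q - a) b ≡ true
        b∈Q-a = proj₂ (nonemptyᵇ-witness (Q - a) other)
        b∈Q : lookup Q b ≡ true
        b∈Q = proj₁ (∈-─⁻ Q ⁅ a ⁆ b∈Q-a)
        a≢b : a ≢ b
        a≢b = ∉⁅⁆⇒≢ a b (proj₂ (∈-─⁻ Q ⁅ a ⁆ b∈Q-a))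
        b∈W : lookup W b ≡ true
        b∈W = ⊆ᵇ-sound Q W (∧-trueʳ block) b∈Q

    edgeTerm-correct : ∀ Q x → ∣ Q ∣ ≤ 2 → edgeTerm Q x ≈ vertexTerm Q x
    edgeTerm-correct Q x ∣Q∣≤2 = cases Q (Q ≟S ⁅ a ⁆) ∣Q∣≤2
      where
      cases : ∀ Q → Dec (Q ≡ ⁅ a ⁆) → ∣ Q ∣ ≤ 2 → edgeTerm Q x ≈ vertexTerm Q x
      cases _ (yes ≡.refl) _     = singleton-case x
      cases Q (no Q≢a)     ∣Q∣≤2 = not-singleton Q x ∣Q∣≤2 Q≢a

  -- The involution sum of the Tutte matrix over an enumeration of W is the
  -- sum over the partitions of W: expand both at the first vertex a.
  module _ (two : ∀ e → ∣ trace E e ∣ ≤ 2) where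
    mutual
      invSum≈Φ : ∀ {d} (S : Fin d → Fin n) W → Enumerates S W → invSum T S ≈ Φ W
      invSum≈Φ {zero}  S W W≡⊥ rewrite W≡⊥ = sym (partitionSum-⊥ E v)
      invSum≈Φ {suc d} S W (a∈W , S′-enum) = begin
        T a a * invSum T S′ + pairSum T a S′
          ≈⟨ +-cong (*-congˡ (invSum≈Φ S′ (W - a) S′-enum)) (pairSum≈ a S′ (W - a) S′-enum) ⟩
        T a a * Φ (W - a) + sum (λ j → (T a (S′ j) * T a (S′ j)) * Φ (W - a - S′ j))
          ≈⟨ +-cong (diagonal-term a (Φ (W - a)))
                    (sum-cong-≋ (λ j → pair-term a (S′ j) (a≢S′ j) (Φ (W - a - S′ j)))) ⟩
        sum L + sum (λ j → sum (λ e → P j e))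
          ≈⟨ +-congˡ (∑-comm P) ⟩
        sum L + sum (λ e → sum (λ j → P j e))
          ≈⟨ ∑-distrib-+ L (λ e → sum (λ j → P j e)) ⟨
        sum (λ e → edgeTerm (trace E e) (v e))
          ≈⟨ sum-cong-≋ (λ e → edgeTerm-correct (trace E e) (v e) (two e)) ⟩
        vertexExpansion E v a W
          ≈⟨ partitionSum-vertex E v W a a∈W ⟨
        Φ W ∎
        where
        a : Fin n
        a = S zero
        S′ : Fin d → Fin n
        S′ = S ∘ suc
        open AtVertex W a S′ a∈W S′-enum
        L : Fin r → Carrier
        L e = guard (does (trace E e ≟S ⁅ a ⁆)) ((s * v e) * Φ (W - a))
        P : Fin d → Fin r → Carrier
        P j e = guard (does (trace E e ≟S (⁅ a ⁆ ∪ ⁅ S′ j ⁆))) ((v e * v e) * Φ (W - a - S′ j))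

      pairSum≈ : ∀ {d} a (S′ : Fin d → Fin n) V → Enumerates S′ V →
                 pairSum T a S′ ≈ sum (λ j → (T a (S′ j) * T a (S′ j)) * Φ (V - S′ j))
      pairSum≈ {zero}  a S′ V _       = refl
      pairSum≈ {suc d} a S′ V S′-enum = sum-cong-≋ λ j →
        *-congˡ {T a (S′ j) * T a (S′ j)}
                (invSum≈Φ (removeAt S′ j) (V - S′ j) (proj₂ (Enumerates-removeAt S′ V S′-enum j)))

lemma4p2 : ∀ {c ℓ} (R : CommutativeRing c ℓ) → CharTwo R →
    ∀ {n r} (k : ℕ) (E : Edges n r) (U : Subset n) →
    Uniform k E →
    (∀ e → ∣ E e ∩ U ∣ ≤ 2) →
    ∀ (s : CommutativeRing.Carrier R) (v : Fin r → CommutativeRing.Carrier R) →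
    CommutativeRing._≈_ R
      (Over.det R ∣ U ∣ (Over.tutte R E U s v))
      (Over.matchingSum R E U s v)
lemma4p2 R char2 {r = r} _ E U _ two s v = begin
  det ∣ U ∣ (tutte E U s v)
    ≈⟨ det≈perm ∣ U ∣ (tutte E U s v) T (enum U) (enum U) (λ i j → reflexive (tutte≡T i j)) ⟩
  perm T (enum U) (enum U)
    ≈⟨ perm≈invSum T-sym (enum U) ⟩
  invSum T (enum U)
    ≈⟨ invSum≈Φ two (enum U) U (Enumerates-enum U) ⟩
  partitionSum E v U
    ≈⟨ ΣSubsets-cong r (λ M → reflexive
         (≡.cong (λ b → guard b (weight E v M)) (partitionsᵇ≡isPerfectMatching E M))) ⟩
  matchingSum E U s v ∎
  where
  open CommutativeRing R using (reflexive; setoid)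
  open Over R using (det; tutte; matchingSum)
  open Relation.Binary.Reasoning.Setoid setoid
  open CharTwoSums R char2 using (ΣSubsets-cong)
  open Permanents R char2 using (det≈perm; perm; perm≈invSum; invSum)
  open Enumerations using (Enumerates-enum)
  open Partitions U using (partitionsᵇ≡isPerfectMatching)
  open PartitionSums R char2 U s using (partitionSum; guard; weight)
  open TutteMatrix R char2 E U s v using (T; T-sym; tutte≡T; invSum≈Φ)
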